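{- Let $1\le\ell<m$ and consider the Borda rule on $m$ candidates (positional scoring function $\beta(p)=m-p$). Then the worst/best-score algorithm for $\ell$-truncated elections (described in the context) is an $r$-approximation algorithm for Borda on $\ell$-truncated instances with $$r=\frac{\ell}{m+\frac{\ell}{m-1}\cdot\ell};$$ i.e. for every election $E$, the candidate $w$ returned on $\mathrm{trunc}(E,\ell)$ satisfies $\mathrm{sc}_\beta(w)\ge r\cdot\max_{c\in C}\mathrm{sc}_\beta(c)$.
   Context: An election $E=(V,C)$ has voters with strict linear orders over $m$ candidates $C$; $\mathrm{pos}_i(c)$ is the position of $c$ for voter $v_i$, and $\mathrm{sc}_\beta(c)=\sum_{v_i}(m-\mathrm{pos}_i(c))$ is the Borda score. The $\ell$-truncated instance $\mathrm{trunc}(E,\ell)$ contains, for each voter, only the ranking of her top $\ell$ candidates. Algorithm: for each candidate $c$, $\mathrm{worst}(c)$ is the Borda score of $c$ when it keeps its position in each voter's top $\ell$ where it appears and is placed last (position $m$) by every other voter; $\mathrm{best}(c)$ is its Borda score when instead placed at position $\ell+1$ by every voter not ranking it in the top $\ell$. Let $a$ have highest $\mathrm{worst}$, $b_1$ highest $\mathrm{best}$, and $b_2$ the highest $\mathrm{best}$ among candidates other than $b_1$. Return $a$ if $\mathrm{worst}(a)/\mathrm{best}(b_1)\ge\mathrm{worst}(b_1)/\mathrm{best}(b_2)$, else return $b_1$. -}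

module Defs where

open import Data.Nat using (ℕ; zero; suc; _+_; _*_; _∸_; _≤_; _<_; _≤?_)
open import Data.Fin using (Fin; toℕ; inject≤; _≟_)
open import Data.Fin.Properties using (any?)
open import Data.Fin.Permutation using (Permutation′; _⟨$⟩ʳ_; _⟨$⟩ˡ_)
open import Data.Product using (_,_; ∃; _×_)
open import Relation.Binary.PropositionalEquality using (_≡_; _≢_)
open import Relation.Nullary using (yes; no)

Σ[_] : ∀ {n} → (Fin n → ℕ) → ℕ
Σ[_] {zero}  f = 0
Σ[_] {suc n} f = f Fin.zero + Σ[ (λ i → f (Fin.suc i)) ]

-- Voter i is a strict linear order given as a bijection
-- candidate ↦ position, positions being 0-based (position p in the
-- paper, 1 ≤ p ≤ m, corresponds to the Fin m element p-1).
Election : ℕ → ℕ → Set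
Election n m = Fin n → Permutation′ m

pos : ∀ {n m} → Election n m → Fin n → Fin m → ℕ
pos E i c = suc (toℕ (E i ⟨$⟩ʳ c))

bordaScore : ∀ {n m} → Election n m → Fin m → ℕ
bordaScore {m = m} E c = Σ[ (λ i → m ∸ pos E i c) ]

-- ℓ-truncated instance: each voter's top ℓ candidates, in order
-- (entry j, 0-based, is the candidate at position j+1).
Truncated : ℕ → ℕ → ℕ → Set
Truncated n m ℓ = Fin n → Fin ℓ → Fin m

trunc : ∀ {n m} → Election n m → (ℓ : ℕ) → ℓ ≤ m → Truncated n m ℓ
trunc E ℓ ℓ≤m i j = E i ⟨$⟩ˡ inject≤ j ℓ≤m

voteScore : ∀ {m ℓ} → (Fin ℓ → Fin m) → Fin m → ℕ → ℕ
voteScore {m} top c dflt with any? (λ j → top j ≟ c)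
... | yes (j , _) = m ∸ suc (toℕ j)
... | no _        = dflt

-- worst(c): unranked ⇒ position m (score m - m = 0).
worst : ∀ {n m ℓ} → Truncated n m ℓ → Fin m → ℕ
worst {m = m} T c = Σ[ (λ i → voteScore (T i) c (m ∸ m)) ]

-- best(c): unranked ⇒ position ℓ+1 (score m - (ℓ+1)).
best : ∀ {n m ℓ} → Truncated n m ℓ → Fin m → ℕ
best {m = m} {ℓ} T c = Σ[ (λ i → voteScore (T i) c (m ∸ suc ℓ)) ]

-- Final choice: return a iff worst(a)/best(b₁) ≥ worst(b₁)/best(b₂),
-- comparison done by cross-multiplication in ℕ:
-- worst(b₁)·best(b₁) ≤ worst(a)·best(b₂).
choose : ∀ {n m ℓ} → Truncated n m ℓ → (a b₁ b₂ : Fin m) → Fin m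
choose T a b₁ b₂ with worst T b₁ * best T b₁ ≤? worst T a * best T b₂
... | yes _ = a
... | no _  = b₁

-- w is a possible output of the algorithm on T (ties in the argmax
-- choices of a, b₁, b₂ broken arbitrarily).
AlgOutput : ∀ {n m ℓ} → Truncated n m ℓ → Fin m → Set
AlgOutput {m = m} T w =
  ∃ λ a → ∃ λ b₁ → ∃ λ b₂ →
    ((c : Fin m) → worst T c ≤ worst T a) ×
    ((c : Fin m) → best T c ≤ best T b₁) ×
    b₂ ≢ b₁ ×
    ((c : Fin m) → c ≢ b₁ → best T c ≤ best T b₂) ×
    w ≡ choose T a b₁ b₂

-- Every candidate has worst(c) ≤ sc(c) ≤ best(c). Vote by vote,
-- (m-1)·best(b) ≤ ℓ·worst(b) + (m-1)(m-1-ℓ), and each vote contributes at least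
-- ℓ(m-ℓ) to the total of all worst scores, so m·worst(a) ≥ nℓ(m-ℓ); combined,
-- r·best(b) ≤ worst(a) for every b. If a is returned, sc(c) ≤ best(b₁) ≤ worst(a)/r ≤ sc(a)/r.
-- If b₁ is returned, the algorithm's comparison gives r ≤ worst(a)/best(b₁) < worst(b₁)/best(b₂),
-- and every c ≠ b₁ has sc(c) ≤ best(b₂) ≤ worst(b₁)/r ≤ sc(b₁)/r.
module Submission where

open import Defs
open import Data.Nat using (ℕ; _+_; _*_; _∸_; _≤_; _<_)
open import Data.Fin using (Fin)
open import Data.Nat.Properties using (<⇒≤)

open import Data.Nat using (zero; suc; z≤n; s≤s; _≤?_; _<?_)
open import Data.Nat.Properties
  using (≤-refl; ≤-reflexive; ≤-trans; ≮⇒≥; ≰⇒>; n≮0; n≤1+n; m≤m+n; m≤n+m; n∸n≡0; m∸n≤m; m+[n∸m]≡n;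
         +-mono-≤; +-monoʳ-≤; *-monoˡ-≤; *-monoʳ-≤; ∸-monoʳ-≤; *-assoc; *-comm; *-zeroʳ;
         *-distribʳ-+; *-cancelʳ-≤; +-*-semiring; module ≤-Reasoning)
open import Data.Nat.Solver using (module +-*-Solver)
open import Data.Fin using (zero; suc; toℕ; inject≤; fromℕ<; _≟_)
open import Data.Fin.Properties using (any?; toℕ<n; toℕ-inject≤; toℕ-fromℕ<; toℕ-injective)
open import Data.Fin.Permutation using (Permutation′; _⟨$⟩ʳ_; _⟨$⟩ˡ_; inverseʳ; inverseˡ)
open import Data.Product using (_,_; _×_)
open import Data.Sum using (_⊎_; inj₁; inj₂)
open import Relation.Binary.PropositionalEquality
  using (_≡_; refl; sym; trans; cong; cong₂; subst; subst₂; module ≡-Reasoning)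
open import Relation.Nullary using (yes; no; ¬_)
open import Relation.Nullary.Negation using (contradiction)
open import Algebra.Properties.Semiring.Sum +-*-semiring
  using (sum; sum-cong-≗; ∑-distrib-+; ∑-comm; ∑-permute; *-distribˡ-sum)

Σ≡sum : ∀ {n} (f : Fin n → ℕ) → Σ[ f ] ≡ sum f
Σ≡sum {zero}  f = refl
Σ≡sum {suc n} f = cong (f zero +_) (Σ≡sum (λ i → f (suc i)))

Σ-cong : ∀ {n} {f g : Fin n → ℕ} → (∀ i → f i ≡ g i) → Σ[ f ] ≡ Σ[ g ]
Σ-cong {f = f} {g} f≗g = trans (Σ≡sum f) (trans (sum-cong-≗ f≗g) (sym (Σ≡sum g)))

Σ-mono-≤ : ∀ {n} {f g : Fin n → ℕ} → (∀ i → f i ≤ g i) → Σ[ f ] ≤ Σ[ g ]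
Σ-mono-≤ {zero}  f≤g = z≤n
Σ-mono-≤ {suc n} f≤g = +-mono-≤ (f≤g zero) (Σ-mono-≤ (λ i → f≤g (suc i)))

Σ-const : ∀ n (k : ℕ) → Σ[ (λ (_ : Fin n) → k) ] ≡ n * k
Σ-const zero    k = refl
Σ-const (suc n) k = cong (k +_) (Σ-const n k)

Σ-distrib-+ : ∀ {n} (f g : Fin n → ℕ) → Σ[ (λ i → f i + g i) ] ≡ Σ[ f ] + Σ[ g ]
Σ-distrib-+ {n} f g = begin
  Σ[ (λ i → f i + g i) ]  ≡⟨ Σ≡sum {n} _ ⟩
  sum (λ i → f i + g i)   ≡⟨ ∑-distrib-+ f g ⟩
  sum f + sum g           ≡⟨ sym (cong₂ _+_ (Σ≡sum f) (Σ≡sum g)) ⟩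
  Σ[ f ] + Σ[ g ]         ∎
  where open ≡-Reasoning

*-distribˡ-Σ : ∀ {n} k (f : Fin n → ℕ) → k * Σ[ f ] ≡ Σ[ (λ i → k * f i) ]
*-distribˡ-Σ {n} k f = begin
  k * Σ[ f ]             ≡⟨ cong (k *_) (Σ≡sum f) ⟩
  k * sum f              ≡⟨ *-distribˡ-sum k f ⟩
  sum (λ i → k * f i)    ≡⟨ sym (Σ≡sum {n} _) ⟩
  Σ[ (λ i → k * f i) ]   ∎
  where open ≡-Reasoning

Σ-comm : ∀ {n m} (f : Fin n → Fin m → ℕ) →
  Σ[ (λ i → Σ[ f i ]) ] ≡ Σ[ (λ j → Σ[ (λ i → f i j) ]) ]
Σ-comm {n} {m} f = begin
  Σ[ (λ i → Σ[ f i ]) ]               ≡⟨ Σ-cong (λ i → Σ≡sum (f i)) ⟩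
  Σ[ (λ i → sum (f i)) ]              ≡⟨ Σ≡sum {n} _ ⟩
  sum (λ i → sum (f i))               ≡⟨ ∑-comm f ⟩
  sum (λ j → sum (λ i → f i j))       ≡⟨ sym (Σ≡sum {m} _) ⟩
  Σ[ (λ j → sum (λ i → f i j)) ]      ≡⟨ sym (Σ-cong (λ j → Σ≡sum (λ i → f i j))) ⟩
  Σ[ (λ j → Σ[ (λ i → f i j) ]) ]     ∎
  where open ≡-Reasoning

Σ-permute : ∀ {m} (f : Fin m → ℕ) (π : Permutation′ m) → Σ[ (λ c → f (π ⟨$⟩ʳ c)) ] ≡ Σ[ f ]
Σ-permute {m} f π = begin
  Σ[ (λ c → f (π ⟨$⟩ʳ c)) ]  ≡⟨ Σ≡sum {m} _ ⟩
  sum (λ c → f (π ⟨$⟩ʳ c))   ≡⟨ sym (∑-permute f π) ⟩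
  sum f                      ≡⟨ sym (Σ≡sum f) ⟩
  Σ[ f ]                     ∎
  where open ≡-Reasoning

Σ-prefix-lower : ∀ {n} (f : Fin n → ℕ) L k → L ≤ n → (∀ i → toℕ i < L → k ≤ f i) → L * k ≤ Σ[ f ]
Σ-prefix-lower f zero    k _         _    = z≤n
Σ-prefix-lower f (suc L) k (s≤s L≤n) k≤f =
  +-mono-≤ (k≤f zero (s≤s z≤n))
           (Σ-prefix-lower (λ i → f (suc i)) L k L≤n (λ i i<L → k≤f (suc i) (s≤s i<L)))

-- Read x * y ≤ u * v as x / u ≤ v / y: from k / R ≤ A / B < w / B′ conclude k / R ≤ w / B′.
ratio-≤-<-trans : ∀ k R {A B w B′} → k * B ≤ R * A → A * B′ < w * B → k * B′ ≤ R * w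
ratio-≤-<-trans _ _ {A} {zero} {w} {B′} _ AB′<w0 = contradiction (subst (A * B′ <_) (*-zeroʳ w) AB′<w0) n≮0
ratio-≤-<-trans k R {A} {B@(suc _)} {w} {B′} kB≤RA AB′<wB = *-cancelʳ-≤ (k * B′) (R * w) B (begin
  k * B′ * B    ≡⟨ *-assoc k B′ B ⟩
  k * (B′ * B)  ≡⟨ cong (k *_) (*-comm B′ B) ⟩
  k * (B * B′)  ≡⟨ *-assoc k B B′ ⟨
  k * B * B′    ≤⟨ *-monoˡ-≤ B′ kB≤RA ⟩
  R * A * B′    ≡⟨ *-assoc R A B′ ⟩
  R * (A * B′)  ≤⟨ *-monoʳ-≤ R (<⇒≤ AB′<wB) ⟩
  R * (w * B)   ≡⟨ *-assoc R w B ⟨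
  R * w * B     ∎)
  where open ≤-Reasoning

-- p is a 0-based position; candidates at p ≥ ℓ are unranked and get the default score d.
truncatedScore : ℕ → ℕ → ℕ → ℕ → ℕ
truncatedScore m ℓ d p with p <? ℓ
... | yes _ = m ∸ suc p
... | no _  = d

truncatedScore-ranked : ∀ m ℓ d p → p < ℓ → truncatedScore m ℓ d p ≡ m ∸ suc p
truncatedScore-ranked m ℓ d p p<ℓ with p <? ℓ
... | yes _   = refl
... | no p≮ℓ  = contradiction p<ℓ p≮ℓ

truncatedScore-unranked : ∀ m ℓ d p → ¬ p < ℓ → truncatedScore m ℓ d p ≡ d
truncatedScore-unranked m ℓ d p p≮ℓ with p <? ℓ
... | yes p<ℓ = contradiction p<ℓ p≮ℓ
... | no _    = refl

truncatedScore-worst≤borda : ∀ m ℓ p → truncatedScore m ℓ (m ∸ m) p ≤ m ∸ suc p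
truncatedScore-worst≤borda m ℓ p with p <? ℓ
... | yes _ = ≤-refl
... | no _  = ≤-trans (≤-reflexive (n∸n≡0 m)) z≤n

truncatedScore-borda≤best : ∀ m ℓ p → m ∸ suc p ≤ truncatedScore m ℓ (m ∸ suc ℓ) p
truncatedScore-borda≤best m ℓ p with p <? ℓ
... | yes _   = ≤-refl
... | no p≮ℓ  = ∸-monoʳ-≤ m (s≤s (≮⇒≥ p≮ℓ))

truncatedScore-worst-prefix : ∀ m ℓ p → p < ℓ → m ∸ ℓ ≤ truncatedScore m ℓ (m ∸ m) p
truncatedScore-worst-prefix m ℓ p p<ℓ =
  ≤-trans (∸-monoʳ-≤ m p<ℓ) (≤-reflexive (sym (truncatedScore-ranked m ℓ (m ∸ m) p p<ℓ)))

-- Ranked: with x = m - 1 - p ≤ m - 1 the claim is (m - 1 - ℓ) x ≤ (m - 1)(m - 1 - ℓ).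
-- Unranked: both sides equal (m - 1)(m - 1 - ℓ).
truncatedScore-best≤worst : ∀ m ℓ p → ℓ < m →
  (m ∸ 1) * truncatedScore m ℓ (m ∸ suc ℓ) p
    ≤ ℓ * truncatedScore m ℓ (m ∸ m) p + (m ∸ 1) * (m ∸ suc ℓ)
truncatedScore-best≤worst m ℓ p ℓ<m with p <? ℓ
... | no _ = m≤n+m _ _
truncatedScore-best≤worst (suc M) ℓ p (s≤s ℓ≤M) | yes _ = begin
  M * x              ≡⟨ cong (_* x) (sym (m+[n∸m]≡n ℓ≤M)) ⟩
  (ℓ + D) * x        ≡⟨ *-distribʳ-+ x ℓ D ⟩
  ℓ * x + D * x      ≤⟨ +-monoʳ-≤ (ℓ * x) (*-monoʳ-≤ D (m∸n≤m M p)) ⟩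
  ℓ * x + D * M      ≡⟨ cong (ℓ * x +_) (*-comm D M) ⟩
  ℓ * x + M * D      ∎
  where
  open ≤-Reasoning
  x = M ∸ p
  D = M ∸ ℓ

module _ {n m} (E : Election n m) (ℓ : ℕ) (ℓ≤m : ℓ ≤ m) (i : Fin n) (c : Fin m) where

  position-of-ranked : ∀ j → trunc E ℓ ℓ≤m i j ≡ c → toℕ (E i ⟨$⟩ʳ c) ≡ toℕ j
  position-of-ranked j refl = trans (cong toℕ (inverseʳ (E i))) (toℕ-inject≤ j ℓ≤m)

  ranked-at-position : (p<ℓ : toℕ (E i ⟨$⟩ʳ c) < ℓ) → trunc E ℓ ℓ≤m i (fromℕ< p<ℓ) ≡ c
  ranked-at-position p<ℓ = trans (cong (E i ⟨$⟩ˡ_) inject-p) (inverseˡ (E i))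
    where
    inject-p : inject≤ (fromℕ< p<ℓ) ℓ≤m ≡ E i ⟨$⟩ʳ c
    inject-p = toℕ-injective (trans (toℕ-inject≤ (fromℕ< p<ℓ) ℓ≤m) (toℕ-fromℕ< p<ℓ))

  voteScore-trunc : ∀ d → voteScore (trunc E ℓ ℓ≤m i) c d ≡ truncatedScore m ℓ d (toℕ (E i ⟨$⟩ʳ c))
  voteScore-trunc d with any? (λ j → trunc E ℓ ℓ≤m i j ≟ c)
  ... | yes (j , ranked) = begin
    m ∸ suc (toℕ j)                          ≡⟨ truncatedScore-ranked m ℓ d (toℕ j) (toℕ<n j) ⟨
    truncatedScore m ℓ d (toℕ j)             ≡⟨ cong (truncatedScore m ℓ d) (position-of-ranked j ranked) ⟨
    truncatedScore m ℓ d (toℕ (E i ⟨$⟩ʳ c))  ∎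
    where open ≡-Reasoning
  ... | no unranked = sym (truncatedScore-unranked m ℓ d _ (λ p<ℓ → unranked (_ , ranked-at-position p<ℓ)))

ratioNumerator ratioDenominator : ℕ → ℕ → ℕ
ratioNumerator   m ℓ = ℓ * (m ∸ 1)
ratioDenominator m ℓ = m * (m ∸ 1) + ℓ * ℓ

ratioNumerator≤ratioDenominator : ∀ {m ℓ} → ℓ ≤ m → ratioNumerator m ℓ ≤ ratioDenominator m ℓ
ratioNumerator≤ratioDenominator {m} ℓ≤m = ≤-trans (*-monoˡ-≤ (m ∸ 1) ℓ≤m) (m≤m+n _ _)

module TruncatedScores {n m} (E : Election n m) {ℓ} (ℓ<m : ℓ < m) where

  T : Truncated n m ℓ
  T = trunc E ℓ (<⇒≤ ℓ<m)

  position : Fin n → Fin m → ℕ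
  position i c = toℕ (E i ⟨$⟩ʳ c)

  private
    voteScore-T : ∀ i c d → voteScore (T i) c d ≡ truncatedScore m ℓ d (position i c)
    voteScore-T i c = voteScore-trunc E ℓ (<⇒≤ ℓ<m) i c

  worst≤bordaScore : ∀ c → worst T c ≤ bordaScore E c
  worst≤bordaScore c = Σ-mono-≤ {n} λ i →
    ≤-trans (≤-reflexive (voteScore-T i c (m ∸ m))) (truncatedScore-worst≤borda m ℓ (position i c))

  bordaScore≤best : ∀ c → bordaScore E c ≤ best T c
  bordaScore≤best c = Σ-mono-≤ {n} λ i →
    ≤-trans (truncatedScore-borda≤best m ℓ (position i c)) (≤-reflexive (sym (voteScore-T i c (m ∸ suc ℓ))))

  best≤worst : ∀ b → (m ∸ 1) * best T b ≤ ℓ * worst T b + n * ((m ∸ 1) * (m ∸ suc ℓ))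
  best≤worst b = begin
    (m ∸ 1) * best T b
      ≡⟨ *-distribˡ-Σ {n} (m ∸ 1) _ ⟩
    Σ[ (λ i → (m ∸ 1) * voteScore (T i) b (m ∸ suc ℓ)) ]
      ≤⟨ Σ-mono-≤ {n} (λ i → subst₂ (λ u v → (m ∸ 1) * u ≤ ℓ * v + C)
           (sym (voteScore-T i b (m ∸ suc ℓ))) (sym (voteScore-T i b (m ∸ m)))
           (truncatedScore-best≤worst m ℓ (position i b) ℓ<m)) ⟩
    Σ[ (λ i → ℓ * voteScore (T i) b (m ∸ m) + C) ]
      ≡⟨ Σ-distrib-+ {n} _ _ ⟩
    Σ[ (λ i → ℓ * voteScore (T i) b (m ∸ m)) ] + Σ[ (λ (_ : Fin n) → C) ]
      ≡⟨ cong₂ _+_ (sym (*-distribˡ-Σ {n} ℓ _)) (Σ-const n C) ⟩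
    ℓ * worst T b + n * C ∎
    where
    C = (m ∸ 1) * (m ∸ suc ℓ)
    open ≤-Reasoning

  Σ-worst-lower : n * (ℓ * (m ∸ ℓ)) ≤ Σ[ worst T ]
  Σ-worst-lower = begin
    n * (ℓ * (m ∸ ℓ))                                        ≡⟨ Σ-const n _ ⟨
    Σ[ (λ (_ : Fin n) → ℓ * (m ∸ ℓ)) ]                       ≤⟨ Σ-mono-≤ {n} vote-lower ⟩
    Σ[ (λ i → Σ[ (λ c → voteScore (T i) c (m ∸ m)) ]) ]      ≡⟨ Σ-comm (λ i c → voteScore (T i) c (m ∸ m)) ⟩
    Σ[ worst T ]                                             ∎
    where
    open ≤-Reasoning
    vote-lower : ∀ i → ℓ * (m ∸ ℓ) ≤ Σ[ (λ c → voteScore (T i) c (m ∸ m)) ]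
    vote-lower i = begin
      ℓ * (m ∸ ℓ)
        ≤⟨ Σ-prefix-lower {m} _ ℓ (m ∸ ℓ) (<⇒≤ ℓ<m) (λ p → truncatedScore-worst-prefix m ℓ (toℕ p)) ⟩
      Σ[ (λ (p : Fin m) → truncatedScore m ℓ (m ∸ m) (toℕ p)) ]
        ≡⟨ Σ-permute (λ p → truncatedScore m ℓ (m ∸ m) (toℕ p)) (E i) ⟨
      Σ[ (λ c → truncatedScore m ℓ (m ∸ m) (position i c)) ]
        ≡⟨ Σ-cong (λ c → voteScore-T i c (m ∸ m)) ⟨
      Σ[ (λ c → voteScore (T i) c (m ∸ m)) ] ∎

  best≤maxWorst : ∀ {a} → (∀ c → worst T c ≤ worst T a) →
    ∀ b → ratioNumerator m ℓ * best T b ≤ ratioDenominator m ℓ * worst T a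
  best≤maxWorst {a} worst≤A b = begin
    ℓ * M₁ * B                        ≡⟨ *-assoc ℓ M₁ B ⟩
    ℓ * (M₁ * B)                      ≤⟨ *-monoʳ-≤ ℓ (best≤worst b) ⟩
    ℓ * (ℓ * w + n * (M₁ * D))        ≡⟨ regroup ⟩
    ℓ * ℓ * w + M₁ * (n * (ℓ * D))    ≤⟨ +-mono-≤ (*-monoʳ-≤ (ℓ * ℓ) (worst≤A b)) (*-monoʳ-≤ M₁ nℓD≤mA) ⟩
    ℓ * ℓ * A + M₁ * (m * A)          ≡⟨ factor ⟩
    (m * M₁ + ℓ * ℓ) * A              ∎
    where
    open ≤-Reasoning
    open +-*-Solver
    M₁ = m ∸ 1
    D = m ∸ suc ℓ
    A = worst T a
    B = best T b
    w = worst T b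
    nℓD≤mA : n * (ℓ * D) ≤ m * A
    nℓD≤mA = begin
      n * (ℓ * D)          ≤⟨ *-monoʳ-≤ n (*-monoʳ-≤ ℓ (∸-monoʳ-≤ m (n≤1+n ℓ))) ⟩
      n * (ℓ * (m ∸ ℓ))    ≤⟨ Σ-worst-lower ⟩
      Σ[ worst T ]         ≤⟨ Σ-mono-≤ {m} worst≤A ⟩
      Σ[ (λ (_ : Fin m) → A) ] ≡⟨ Σ-const m A ⟩
      m * A                ∎
    regroup : ℓ * (ℓ * w + n * (M₁ * D)) ≡ ℓ * ℓ * w + M₁ * (n * (ℓ * D))
    regroup = solve 5 (λ l x k j d → l :* (l :* x :+ k :* (j :* d)) := l :* l :* x :+ j :* (k :* (l :* d)))
                refl ℓ w n M₁ D
    factor : ℓ * ℓ * A + M₁ * (m * A) ≡ (m * M₁ + ℓ * ℓ) * A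
    factor = solve 4 (λ l x j k → l :* l :* x :+ j :* (k :* x) := (k :* j :+ l :* l) :* x) refl ℓ A M₁ m

  bordaScore-ratio : ∀ c w → ratioNumerator m ℓ * best T c ≤ ratioDenominator m ℓ * worst T w →
    ratioNumerator m ℓ * bordaScore E c ≤ ratioDenominator m ℓ * bordaScore E w
  bordaScore-ratio c w bound =
    ≤-trans (*-monoʳ-≤ (ratioNumerator m ℓ) (bordaScore≤best c))
      (≤-trans bound (*-monoʳ-≤ (ratioDenominator m ℓ) (worst≤bordaScore w)))

choose-cases : ∀ {n m ℓ} (T : Truncated n m ℓ) a b₁ b₂ →
  choose T a b₁ b₂ ≡ a ⊎ (choose T a b₁ b₂ ≡ b₁ × worst T a * best T b₂ < worst T b₁ * best T b₁)
choose-cases T a b₁ b₂ with worst T b₁ * best T b₁ ≤? worst T a * best T b₂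
... | yes _ = inj₁ refl
... | no ≰  = inj₂ (refl , ≰⇒> ≰)

module _ {n m} (E : Election n m) {ℓ} (ℓ<m : ℓ < m) where
  open TruncatedScores E ℓ<m

  private
    k R : ℕ
    k = ratioNumerator m ℓ
    R = ratioDenominator m ℓ

  algOutput-approximates : ∀ {w} → AlgOutput T w → ∀ c → k * bordaScore E c ≤ R * bordaScore E w
  algOutput-approximates (a , b₁ , b₂ , worst≤a , best≤b₁ , _ , best≤b₂ , refl) c
    with choose-cases T a b₁ b₂
  ... | inj₁ chose-a rewrite chose-a =
    bordaScore-ratio c a (≤-trans (*-monoʳ-≤ k (best≤b₁ c)) (best≤maxWorst worst≤a b₁))
  ... | inj₂ (chose-b₁ , a<b₁) rewrite chose-b₁ with c ≟ b₁
  ...   | yes refl = *-monoˡ-≤ (bordaScore E c) (ratioNumerator≤ratioDenominator (<⇒≤ ℓ<m))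
  ...   | no c≢b₁ = bordaScore-ratio c b₁
    (≤-trans (*-monoʳ-≤ k (best≤b₂ c c≢b₁)) (ratio-≤-<-trans k R (best≤maxWorst worst≤a b₁) a<b₁))

corollary3 : (n m ℓ : ℕ) → 1 ≤ ℓ → (ℓ<m : ℓ < m) → (E : Election n m)
    → (w : Fin m) → AlgOutput (trunc E ℓ (<⇒≤ ℓ<m)) w
    → (c : Fin m)
    → ℓ * (m ∸ 1) * bordaScore E c ≤ (m * (m ∸ 1) + ℓ * ℓ) * bordaScore E w
corollary3 n m ℓ _ ℓ<m E w = algOutput-approximates E ℓ<m
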